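{- Let $(T_r)_{r\in\mathbb{Z}}$ be the Tribonacci sequence. Then for every non-negative integer $k$: \[ 8\sum_{j=0}^k T_{2j}^2 = 8T_{2k}^2 + T_{2k-1}^2 + 6T_{2k-2}^2 - 2T_{2k-3}^2 - T_{2k-5}^2 . \]
   Context: The Tribonacci sequence $(T_r)_{r\in\mathbb{Z}}$ is defined by $T_0=0$, $T_1=1$, $T_2=1$ and $T_r=T_{r-1}+T_{r-2}+T_{r-3}$ for all integers $r$ (this determines $T_r$ for negative $r$ as well, e.g. $T_{ -1}=0$, $T_{ -2}=1$, $T_{ -3}=-1$). -}

module Defs where

open import Data.Nat using (ℕ; zero; suc)
open import Data.Integer using (ℤ; +_; -[1+_]; _+_; _-_; _*_)

Tpos : ℕ → ℤ
Tpos 0 = + 0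
Tpos 1 = + 1
Tpos 2 = + 1
Tpos (suc (suc (suc n))) = Tpos (suc (suc n)) + Tpos (suc n) + Tpos n

-- Tneg n = T_{-n}, from the recurrence run backwards:
-- T_{-n-3} = T_{-n} - T_{-n-1} - T_{-n-2}; T_0 = 0, T_{-1} = 0, T_{-2} = 1.
Tneg : ℕ → ℤ
Tneg 0 = + 0
Tneg 1 = + 0
Tneg 2 = + 1
Tneg (suc (suc (suc n))) = Tneg n - Tneg (suc n) - Tneg (suc (suc n))

T : ℤ → ℤ
T (+ n) = Tpos n
T -[1+ n ] = Tneg (suc n)

sumTo : ℕ → (ℕ → ℤ) → ℤ
sumTo zero f = f 0
sumTo (suc k) f = sumTo k f + f (suc k)

-- Write R(x) for the right-hand side at x = 2k. For x ≥ 5 the recurrence gives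
-- R(x + 2) − R(x) = 8 T(x + 2)², so both sides grow by the same amount from k to k + 1;
-- the cases k ≤ 3 (where negative indices occur) are checked by evaluation.
module Submission where

open import Defs
open import Data.Nat using (ℕ; zero; suc)
import Data.Nat as ℕ
import Data.Nat.Properties as ℕ
open import Data.Integer using (ℤ; +_; _+_; _-_; _*_; _^_)
open import Data.Integer.Properties using (*-distribˡ-+)
open import Data.Integer.Solver using (module +-*-Solver)
open +-*-Solver using (solve; _:+_; _:-_; _:*_; _:^_; _:=_; con)
open import Relation.Binary.PropositionalEquality using (_≡_; refl; cong; cong₂; module ≡-Reasoning)
open ≡-Reasoning

IsTribonacci : (ℕ → ℤ) → Set
IsTribonacci u = ∀ n → u (3 ℕ.+ n) ≡ u (2 ℕ.+ n) + u (1 ℕ.+ n) + u n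

Tpos-isTribonacci : IsTribonacci Tpos
Tpos-isTribonacci n = refl

tribonacci-backward : ∀ {u} → IsTribonacci u → ∀ n → u n ≡ + 2 * u (3 ℕ.+ n) - u (4 ℕ.+ n)
tribonacci-backward rec n = backward (rec n) (rec (1 ℕ.+ n))
  where
  backward : ∀ {a b c d e} → d ≡ c + b + a → e ≡ d + c + b → a ≡ + 2 * d - e
  backward {a} {b} {c} refl refl =
    solve 3 (λ a b c → a := con (+ 2) :* (c :+ b :+ a) :- (c :+ b :+ a :+ c :+ b)) refl a b c

-- The right-hand side of the theorem at index 5 + n, so that no index is negative.
squareCombination : (ℕ → ℤ) → ℕ → ℤ
squareCombination u n =
  + 8 * u (5 ℕ.+ n) ^ 2 + u (4 ℕ.+ n) ^ 2 + + 6 * u (3 ℕ.+ n) ^ 2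
    - + 2 * u (2 ℕ.+ n) ^ 2 - u n ^ 2

squareCombination-step : ∀ {u} → IsTribonacci u → ∀ n →
  squareCombination u (2 ℕ.+ n) ≡ squareCombination u n + + 8 * u (7 ℕ.+ n) ^ 2
squareCombination-step {u} rec n =
  step (u (7 ℕ.+ n)) (tribonacci-backward {u} rec n) (rec (2 ℕ.+ n)) (rec (3 ℕ.+ n))
  where
  -- Expressing u n backwards through u (3 + n) and u (4 + n) leaves an identity in four variables.
  step : ∀ w {a c d e f g} → a ≡ + 2 * d - e → f ≡ e + d + c → g ≡ f + e + d →
    + 8 * w ^ 2 + g ^ 2 + + 6 * f ^ 2 - + 2 * e ^ 2 - c ^ 2
      ≡ + 8 * f ^ 2 + e ^ 2 + + 6 * d ^ 2 - + 2 * c ^ 2 - a ^ 2 + + 8 * w ^ 2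
  step w {c = c} {d} {e} refl refl refl = solve 4 (λ w c d e →
    con (+ 8) :* w :^ 2 :+ (e :+ d :+ c :+ e :+ d) :^ 2 :+ con (+ 6) :* (e :+ d :+ c) :^ 2
      :- con (+ 2) :* e :^ 2 :- c :^ 2
    := con (+ 8) :* (e :+ d :+ c) :^ 2 :+ e :^ 2 :+ con (+ 6) :* d :^ 2 :- con (+ 2) :* c :^ 2
      :- (con (+ 2) :* d :- e) :^ 2 :+ con (+ 8) :* w :^ 2) refl w c d e

eightSumEvenSquares : ∀ n →
  + 8 * sumTo (3 ℕ.+ n) (λ j → T (+ 2 * + j) ^ 2) ≡ squareCombination Tpos (1 ℕ.+ 2 ℕ.* n)
eightSumEvenSquares zero = refl
eightSumEvenSquares (suc n) = begin
  + 8 * (S + Tpos (2 ℕ.* (4 ℕ.+ n)) ^ 2)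
    ≡⟨ *-distribˡ-+ (+ 8) S _ ⟩
  + 8 * S + + 8 * Tpos (2 ℕ.* (4 ℕ.+ n)) ^ 2
    ≡⟨ cong₂ _+_ (eightSumEvenSquares n) (cong (λ m → + 8 * Tpos m ^ 2) (ℕ.*-distribˡ-+ 2 4 n)) ⟩
  squareCombination Tpos (1 ℕ.+ 2 ℕ.* n) + + 8 * Tpos (7 ℕ.+ (1 ℕ.+ 2 ℕ.* n)) ^ 2
    ≡⟨ squareCombination-step {Tpos} Tpos-isTribonacci (1 ℕ.+ 2 ℕ.* n) ⟨
  squareCombination Tpos (3 ℕ.+ 2 ℕ.* n)
    ≡⟨ cong (λ m → squareCombination Tpos (1 ℕ.+ m)) (ℕ.*-distribˡ-+ 2 1 n) ⟨
  squareCombination Tpos (1 ℕ.+ 2 ℕ.* (1 ℕ.+ n)) ∎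
  where S = sumTo (3 ℕ.+ n) (λ j → T (+ 2 * + j) ^ 2)

mainTheorem5 : (k : ℕ) →
    + 8 * sumTo k (λ j → T (+ 2 * + j) ^ 2)
      ≡ + 8 * T (+ 2 * + k) ^ 2 + T (+ 2 * + k - + 1) ^ 2 + + 6 * T (+ 2 * + k - + 2) ^ 2
        - + 2 * T (+ 2 * + k - + 3) ^ 2 - T (+ 2 * + k - + 5) ^ 2
mainTheorem5 0 = refl
mainTheorem5 1 = refl
mainTheorem5 2 = refl
mainTheorem5 (suc (suc (suc n))) = begin
  + 8 * sumTo (3 ℕ.+ n) (λ j → T (+ 2 * + j) ^ 2) ≡⟨ eightSumEvenSquares n ⟩
  squareCombination Tpos (1 ℕ.+ 2 ℕ.* n)          ≡⟨⟩
  rhs (+ (6 ℕ.+ 2 ℕ.* n))                         ≡⟨ cong (λ m → rhs (+ m)) (ℕ.*-distribˡ-+ 2 3 n) ⟨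
  rhs (+ (2 ℕ.* (3 ℕ.+ n)))                       ∎
  where
  rhs : ℤ → ℤ
  rhs x = + 8 * T x ^ 2 + T (x - + 1) ^ 2 + + 6 * T (x - + 2) ^ 2 - + 2 * T (x - + 3) ^ 2 - T (x - + 5) ^ 2
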